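{- For every term $\mathfrak{t}$ of the Mockingbird CLS, the posets $\mathcal{P}(\mathfrak{t})$ and $\mathcal{D}^*(\mathrm{fr}(\mathfrak{t}))$ are isomorphic.
   Context: Terms over $\{{\rm M}\}$: the smallest set containing variables $\mathsf{x}_1,\mathsf{x}_2,\dots$, the symbol ${\rm M}$, and $(\mathfrak{t}_1\mathfrak{t}_2)$ for terms $\mathfrak{t}_1,\mathfrak{t}_2$ (application associates to the left). The rewrite relation $\Rightarrow$ is the smallest relation with ${\rm M}\,\mathfrak{s} \Rightarrow \mathfrak{s}\,\mathfrak{s}$ for every term $\mathfrak{s}$, closed under $\mathfrak{t}_1 \Rightarrow \mathfrak{t}_1'$ implies $\mathfrak{t}_1\mathfrak{t}_2 \Rightarrow \mathfrak{t}_1'\mathfrak{t}_2$ and $\mathfrak{t}_2\mathfrak{t}_1 \Rightarrow \mathfrak{t}_2\mathfrak{t}_1'$; its reflexive-transitive closure $\preccurlyeq$ is a partial order, and $\mathcal{P}(\mathfrak{t})$ is the poset $\{\mathfrak{t}' : \mathfrak{t}\preccurlyeq\mathfrak{t}'\}$ ordered by $\preccurlyeq$. A duplicative tree is a planar rooted tree with each node colored white or black; a duplicative forest is a finite word of duplicative trees ($\epsilon$ the empty forest). For a forest $\mathfrak{f}$, $\circ(\mathfrak{f})$ (resp. $\bullet(\mathfrak{f})$) is the tree with white (resp. black) root and sequence of subtrees $\mathfrak{f}$; concatenation is written $\mathfrak{f}\mathfrak{f}'$. $\mathfrak{f}\Rightarrow_{\mathcal{D}}\mathfrak{f}'$ if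 $\mathfrak{f}'$ is obtained by choosing a white node of $\mathfrak{f}$ with subtree $\circ(\mathfrak{g})$ and replacing it with $\bullet(\mathfrak{g}\mathfrak{g})$; $\ll$ is the reflexive-transitive closure and $\mathcal{D}^*(\mathfrak{f})$ is the poset $\{\mathfrak{f}' : \mathfrak{f}\ll\mathfrak{f}'\}$ ordered by $\ll$. The map $\mathrm{fr}$ from terms to duplicative forests is defined by: $\mathrm{fr}(\mathsf{x}_i) = \mathrm{fr}({\rm M}) = \mathrm{fr}({\rm M}{\rm M}) = \epsilon$; $\mathrm{fr}({\rm M}\,\mathsf{x}_i) = \circ(\epsilon)$ (a single white node); $\mathrm{fr}({\rm M}(\mathfrak{t}\mathfrak{t}')) = \circ(\mathrm{fr}(\mathfrak{t}\mathfrak{t}'))$; $\mathrm{fr}(\mathsf{x}_i\,\mathfrak{t}) = \mathrm{fr}(\mathfrak{t})$; and $\mathrm{fr}((\mathfrak{t}\mathfrak{t}')\mathfrak{t}'') = \mathrm{fr}(\mathfrak{t}\mathfrak{t}')\,\mathrm{fr}(\mathfrak{t}'')$ (concatenation), for all variables $\mathsf{x}_i$ and terms $\mathfrak{t},\mathfrak{t}',\mathfrak{t}''$. -}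

module Defs where

open import Data.Nat using (ℕ)
open import Data.List using (List; []; _∷_; _++_; [_])
open import Data.Product using (Σ; proj₁; proj₂)
open import Relation.Binary.PropositionalEquality using (_≡_)
open import Relation.Binary.Construct.Closure.ReflexiveTransitive using (Star)
open import Function.Bundles using (_⇔_)

infixl 9 _·_

data Term : Set where
  var : ℕ → Term
  M   : Term
  _·_ : Term → Term → Term

infix 4 _⇒_
data _⇒_ : Term → Term → Set where
  M-rule : ∀ s → M · s ⇒ s · s
  appˡ   : ∀ {t₁ t₁'} t₂ → t₁ ⇒ t₁' → t₁ · t₂ ⇒ t₁' · t₂
  appʳ   : ∀ {t₁ t₁'} t₂ → t₁ ⇒ t₁' → t₂ · t₁ ⇒ t₂ · t₁'

infix 4 _≼_
_≼_ : Term → Term → Set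
_≼_ = Star _⇒_

𝒫 : Term → Set
𝒫 t = Σ Term (λ t' → t ≼ t')

data Color : Set where
  white black : Color

data DTree : Set where
  node : Color → List DTree → DTree

Forest : Set
Forest = List DTree

ε : Forest
ε = []

∘ : Forest → DTree
∘ f = node white f

● : Forest → DTree
● f = node black f

infix 4 _⇒Tr_ _⇒D_
data _⇒D_ : Forest → Forest → Set
data _⇒Tr_ : DTree → DTree → Set

data _⇒Tr_ where
  dup    : ∀ g → ∘ g ⇒Tr ● (g ++ g)
  inside : ∀ c {f f'} → f ⇒D f' → node c f ⇒Tr node c f'

data _⇒D_ where
  here  : ∀ {t t'} ts → t ⇒Tr t' → (t ∷ ts) ⇒D (t' ∷ ts)
  there : ∀ t {ts ts'} → ts ⇒D ts' → (t ∷ ts) ⇒D (t ∷ ts')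

infix 4 _≪_
_≪_ : Forest → Forest → Set
_≪_ = Star _⇒D_

𝒟* : Forest → Set
𝒟* f = Σ Forest (λ f' → f ≪ f')

fr : Term → Forest
fr (var i)             = ε
fr M                   = ε
fr (M · M)             = ε
fr (M · var i)         = [ ∘ ε ]
fr (M · (t · t'))      = [ ∘ (fr (t · t')) ]
fr (var i · t)         = fr t
fr ((t · t') · t'')    = fr (t · t') ++ fr t''

-- Order isomorphism between the posets 𝒫(t) (ordered by ≼) and
-- 𝒟*(f) (ordered by ≪).  Elements are compared via their first
-- components (the proof of reachability is irrelevant data).

record PosetIso (t : Term) (f : Forest) : Set where
  field
    to       : 𝒫 t → 𝒟* f
    from     : 𝒟* f → 𝒫 t
    from∘to  : ∀ x → proj₁ (from (to x)) ≡ proj₁ x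
    to∘from  : ∀ y → proj₁ (to (from y)) ≡ proj₁ y
    to-cong  : ∀ x y → proj₁ x ≡ proj₁ y → proj₁ (to x) ≡ proj₁ (to y)
    from-cong : ∀ x y → proj₁ x ≡ proj₁ y → proj₁ (from x) ≡ proj₁ (from y)
    order    : ∀ x y → (proj₁ x ≼ proj₁ y) ⇔ (proj₁ (to x) ≪ proj₁ (to y))

-- Every reduct u of t has a rigid shape relative to t: each
-- redex M s of t with s a variable or an application is either still
-- unfired in u, or has fired to s s, after which the two copies of s
-- evolve independently; every other part of t evolves only inside its
-- arguments (M M only rewrites to itself).  Recording an unfired redex
-- as a white node and a fired one as a black node whose children are
-- the records of the two copies gives a forest encode t u, with
-- encode t t = fr t.  This encoding is injective on reducts, and the
-- steps of the forest correspond exactly to rewriting steps of u.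
module Submission where

open import Defs
open import Data.Nat using (_+_)
open import Data.Nat.Properties using (suc-injective)
open import Data.List using (List; []; _∷_; _++_; length)
open import Data.List.Properties using (length-++; ∷-injectiveˡ; ∷-injectiveʳ)
open import Data.Product using (Σ-syntax; _,_; proj₁; _×_)
open import Data.Sum using (_⊎_; inj₁; inj₂)
open import Level using (Level)
open import Relation.Binary.Core using (Rel)
open import Relation.Binary.PropositionalEquality
open import Relation.Binary.Construct.Closure.Reflexive using (ReflClosure; refl; [_]; map)
open import Relation.Binary.Construct.Closure.ReflexiveTransitive using (Star; _◅_; _◅◅_)
  renaming (ε to ⋆ε)
open import Function.Base using (_∘′_)
open import Function.Bundles using (mk⇔)

private
  variable
    ℓ : Level
    A : Set ℓ
    a b c s u v x y : Term
    f : Forest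

++-cancel-length : ∀ (xs ys : List A) {zs ws} → length xs ≡ length ys →
                   xs ++ zs ≡ ys ++ ws → xs ≡ ys × zs ≡ ws
++-cancel-length []       []       _ e = refl , e
++-cancel-length (x ∷ xs) (y ∷ ys) l e
  with ++-cancel-length xs ys (suc-injective l) (∷-injectiveʳ e)
... | xs≡ys , zs≡ws = cong₂ _∷_ (∷-injectiveˡ e) xs≡ys , zs≡ws

∷[]-node-injective : ∀ {k} {g g' : Forest} → node k g ∷ [] ≡ node k g' ∷ [] → g ≡ g'
∷[]-node-injective refl = refl

⇒D-++ˡ : ∀ {g g'} h → g ⇒D g' → g ++ h ⇒D g' ++ h
⇒D-++ˡ h (here ts d)  = here (ts ++ h) d
⇒D-++ˡ h (there t d) = there t (⇒D-++ˡ h d)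

⇒D-++ʳ : ∀ g {h h'} → h ⇒D h' → g ++ h ⇒D g ++ h'
⇒D-++ʳ []      d = d
⇒D-++ʳ (t ∷ g) d = there t (⇒D-++ʳ g d)

⇒D-singleton : ∀ k {g g'} → g ⇒D g' → node k g ∷ [] ⇒D node k g' ∷ []
⇒D-singleton k d = here [] (inside k d)

⇒D-++⁻ : ∀ g {h f'} → g ++ h ⇒D f' →
         (Σ[ g' ∈ Forest ] g ⇒D g' × f' ≡ g' ++ h) ⊎
         (Σ[ h' ∈ Forest ] h ⇒D h' × f' ≡ g ++ h')
⇒D-++⁻ []      d           = inj₂ (_ , d , refl)
⇒D-++⁻ (t ∷ g) (here _ d)  = inj₁ (_ , here g d , refl)
⇒D-++⁻ (t ∷ g) (there _ d) with ⇒D-++⁻ g d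
... | inj₁ (g' , d' , e) = inj₁ (t ∷ g' , there t d' , cong (t ∷_) e)
... | inj₂ (h' , d' , e) = inj₂ (h' , d' , cong (t ∷_) e)

ReflClosure⇒Star : ∀ {R : Rel A ℓ} {x y} → ReflClosure R x y → Star R x y
ReflClosure⇒Star refl  = ⋆ε
ReflClosure⇒Star [ d ] = d ◅ ⋆ε

⇒-app⇒app : x · y ⇒ u → Σ[ x' ∈ Term ] Σ[ y' ∈ Term ] u ≡ x' · y'
⇒-app⇒app (M-rule _)  = _ , _ , refl
⇒-app⇒app (appˡ _ _) = _ , _ , refl
⇒-app⇒app (appʳ _ _) = _ , _ , refl

-- Reduct t u characterises t ≼ u by the shape of t, following the
-- clauses of fr.
data Reduct : Term → Term → Set where
  var-stuck  : ∀ i → Reduct (var i) (var i)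
  M-stuck    : Reduct M M
  MM-loop    : Reduct (M · M) (M · M)
  Mvar-idle  : ∀ i → Reduct (M · var i) (M · var i)
  Mvar-fired : ∀ i → Reduct (M · var i) (var i · var i)
  Mapp-idle  : Reduct (a · b) s → Reduct (M · (a · b)) (M · s)
  Mapp-fired : Reduct (a · b) (x · y) → Reduct (a · b) s → Reduct (M · (a · b)) ((x · y) · s)
  var·-cong  : ∀ {i} → Reduct s u → Reduct (var i · s) (var i · u)
  app·-cong  : Reduct (a · b) x → Reduct c y → Reduct ((a · b) · c) (x · y)

Reduct-refl : ∀ t → Reduct t t
Reduct-refl (var i)       = var-stuck i
Reduct-refl M             = M-stuck
Reduct-refl (M · M)       = MM-loop
Reduct-refl (M · var i)   = Mvar-idle i
Reduct-refl (M · (a · b)) = Mapp-idle (Reduct-refl (a · b))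
Reduct-refl (var i · s)   = var·-cong (Reduct-refl s)
Reduct-refl ((a · b) · c) = app·-cong (Reduct-refl (a · b)) (Reduct-refl c)

Reduct-app⇒app : Reduct (a · b) u → Σ[ x ∈ Term ] Σ[ y ∈ Term ] u ≡ x · y
Reduct-app⇒app MM-loop          = _ , _ , refl
Reduct-app⇒app (Mvar-idle _)    = _ , _ , refl
Reduct-app⇒app (Mvar-fired _)   = _ , _ , refl
Reduct-app⇒app (Mapp-idle _)    = _ , _ , refl
Reduct-app⇒app (Mapp-fired _ _) = _ , _ , refl
Reduct-app⇒app (var·-cong _)    = _ , _ , refl
Reduct-app⇒app (app·-cong _ _)  = _ , _ , refl

-- Meaningful only when Reduct t u; the remaining clauses are junk.
encode : Term → Term → Forest
encode (var i)       _               = []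
encode M             _               = []
encode (M · M)       _               = []
encode (M · var i)   (M · _)         = ∘ [] ∷ []
encode (M · var i)   _               = ● [] ∷ []
encode (M · (a · b)) (M · u)         = ∘ (encode (a · b) u) ∷ []
encode (M · (a · b)) ((x · y) · u)   = ● (encode (a · b) (x · y) ++ encode (a · b) u) ∷ []
encode (M · (a · b)) _               = []
encode (var i · s)   (_ · u)         = encode s u
encode (var i · s)   _               = []
encode ((a · b) · c) (u₁ · u₂)       = encode (a · b) u₁ ++ encode c u₂
encode ((a · b) · c) _               = []

encode-refl : ∀ t → encode t t ≡ fr t
encode-refl (var i)       = refl
encode-refl M             = refl
encode-refl (M · M)       = refl
encode-refl (M · var i)   = refl
encode-refl (M · (a · b)) = cong (λ g → ∘ g ∷ []) (encode-refl (a · b))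
encode-refl (var i · s)   = encode-refl s
encode-refl ((a · b) · c) = cong₂ _++_ (encode-refl (a · b)) (encode-refl c)

length-encode : ∀ {t} → Reduct t u → length (encode t u) ≡ length (fr t)
length-encode (var-stuck _)    = refl
length-encode M-stuck          = refl
length-encode MM-loop          = refl
length-encode (Mvar-idle _)    = refl
length-encode (Mvar-fired _)   = refl
length-encode (Mapp-idle _)    = refl
length-encode (Mapp-fired _ _) = refl
length-encode (var·-cong r)    = length-encode r
length-encode (app·-cong {a = a} {b = b} {x = x} {c = c} {y = y} r q) = begin
  length (encode (a · b) x ++ encode c y)          ≡⟨ length-++ (encode (a · b) x) ⟩
  length (encode (a · b) x) + length (encode c y)  ≡⟨ cong₂ _+_ (length-encode r) (length-encode q) ⟩
  length (fr (a · b)) + length (fr c)              ≡⟨ length-++ (fr (a · b)) ⟨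
  length (fr (a · b) ++ fr c)                      ∎
  where open ≡-Reasoning

encode-injective : ∀ {t} → Reduct t u → Reduct t v → encode t u ≡ encode t v → u ≡ v
encode-injective (var-stuck _)    (var-stuck _)    _  = refl
encode-injective M-stuck          M-stuck          _  = refl
encode-injective MM-loop          MM-loop          _  = refl
encode-injective (Mvar-idle _)    (Mvar-idle _)    _  = refl
encode-injective (Mvar-idle _)    (Mvar-fired _)   ()
encode-injective (Mvar-fired _)   (Mvar-idle _)    ()
encode-injective (Mvar-fired _)   (Mvar-fired _)   _  = refl
encode-injective (Mapp-idle r)    (Mapp-idle r')   e  =
  cong (M ·_) (encode-injective r r' (∷[]-node-injective e))
encode-injective (Mapp-idle _)    (Mapp-fired _ _) ()
encode-injective (Mapp-fired _ _) (Mapp-idle _)    ()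
encode-injective (Mapp-fired r q) (Mapp-fired r' q') e
  with ++-cancel-length _ _ (trans (length-encode r) (sym (length-encode r'))) (∷[]-node-injective e)
... | e₁ , e₂ = cong₂ _·_ (encode-injective r r' e₁) (encode-injective q q' e₂)
encode-injective (var·-cong r)    (var·-cong r')   e  = cong (var _ ·_) (encode-injective r r' e)
encode-injective (app·-cong r q)  (app·-cong r' q') e
  with ++-cancel-length _ _ (trans (length-encode r) (sym (length-encode r'))) e
... | e₁ , e₂ = cong₂ _·_ (encode-injective r r' e₁) (encode-injective q q' e₂)

-- The reflexive closure is needed for the loop M M ⇒ M M.
Reduct-⇒ : ∀ {t} → Reduct t u → u ⇒ v →
           Reduct t v × ReflClosure _⇒D_ (encode t u) (encode t v)
Reduct-⇒ MM-loop         (M-rule _)  = MM-loop , refl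
Reduct-⇒ MM-loop         (appˡ _ ())
Reduct-⇒ MM-loop         (appʳ _ ())
Reduct-⇒ (Mvar-idle i)   (M-rule _)  = Mvar-fired i , [ here [] (dup []) ]
Reduct-⇒ (Mvar-idle _)   (appˡ _ ())
Reduct-⇒ (Mvar-idle _)   (appʳ _ ())
Reduct-⇒ (Mvar-fired _)  (appˡ _ ())
Reduct-⇒ (Mvar-fired _)  (appʳ _ ())
Reduct-⇒ (Mapp-idle r)   (M-rule _) with Reduct-app⇒app r
... | _ , _ , refl = Mapp-fired r r , [ here [] (dup _) ]
Reduct-⇒ (Mapp-idle _)   (appˡ _ ())
Reduct-⇒ (Mapp-idle r)   (appʳ _ st) with Reduct-⇒ r st
... | r' , d = Mapp-idle r' , map {f = λ g → ∘ g ∷ []} (⇒D-singleton white) d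
Reduct-⇒ (Mapp-fired {a = a} {b = b} {s = s} r q) (appˡ _ st) with Reduct-⇒ r st | ⇒-app⇒app st
... | r' , d | _ , _ , refl = Mapp-fired r' q ,
  map {f = λ g → ● (g ++ encode (a · b) s) ∷ []} (⇒D-singleton black ∘′ ⇒D-++ˡ _) d
Reduct-⇒ (Mapp-fired {a = a} {b = b} {x = x} {y = y} r q) (appʳ _ st) with Reduct-⇒ q st
... | q' , d = Mapp-fired r q' ,
  map {f = λ g → ● (encode (a · b) (x · y) ++ g) ∷ []} (⇒D-singleton black ∘′ ⇒D-++ʳ _) d
Reduct-⇒ (var·-cong _)   (appˡ _ ())
Reduct-⇒ (var·-cong r)   (appʳ _ st) with Reduct-⇒ r st
... | r' , d = var·-cong r' , d
Reduct-⇒ (app·-cong () _) (M-rule _)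
Reduct-⇒ (app·-cong {c = c} {y = y} r q) (appˡ _ st) with Reduct-⇒ r st
... | r' , d = app·-cong r' q , map {f = _++ encode c y} (⇒D-++ˡ _) d
Reduct-⇒ (app·-cong {a = a} {b = b} {x = x} r q) (appʳ _ st) with Reduct-⇒ q st
... | q' , d = app·-cong r q' , map {f = encode (a · b) x ++_} (⇒D-++ʳ _) d

Reduct-≼ : ∀ {t} → Reduct t u → u ≼ v → Reduct t v
Reduct-≼ r ⋆ε         = r
Reduct-≼ r (st ◅ p) = Reduct-≼ (proj₁ (Reduct-⇒ r st)) p

encode-mono : ∀ {t} → Reduct t u → u ≼ v → encode t u ≪ encode t v
encode-mono r ⋆ε         = ⋆ε
encode-mono r (st ◅ p) with Reduct-⇒ r st
... | r' , d = ReflClosure⇒Star d ◅◅ encode-mono r' p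

⇒D-lift : ∀ {t f'} → Reduct t u → encode t u ⇒D f' →
          Σ[ u' ∈ Term ] u ⇒ u' × encode t u' ≡ f'
⇒D-lift (Mvar-idle _)  (here _ (dup _)) = _ , M-rule _ , refl
⇒D-lift (Mvar-fired _) (here _ (inside _ ()))
⇒D-lift (Mvar-fired _) (there _ ())
⇒D-lift (Mapp-idle r)  (here _ (dup _)) with Reduct-app⇒app r
... | _ , _ , refl = _ , M-rule _ , refl
⇒D-lift (Mapp-idle r)  (here _ (inside _ d)) with ⇒D-lift r d
... | _ , st , e = _ , appʳ M st , cong (λ g → ∘ g ∷ []) e
⇒D-lift (Mapp-fired {a = a} {b = b} {x = x} {y = y} {s = s} r q) (here _ (inside _ d))
  with ⇒D-++⁻ (encode (a · b) (x · y)) d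
... | inj₁ (_ , d' , refl) with ⇒D-lift r d'
...   | _ , st , e with ⇒-app⇒app st
...     | _ , _ , refl = _ , appˡ s st , cong (λ g → ● (g ++ encode (a · b) s) ∷ []) e
⇒D-lift (Mapp-fired {a = a} {b = b} {x = x} {y = y} r q) (here _ (inside _ d))
  | inj₂ (_ , d' , refl) with ⇒D-lift q d'
... | _ , st , e = _ , appʳ (x · y) st , cong (λ g → ● (encode (a · b) (x · y) ++ g) ∷ []) e
⇒D-lift (var·-cong r) d with ⇒D-lift r d
... | _ , st , e = _ , appʳ (var _) st , e
⇒D-lift (app·-cong {a = a} {b = b} {x = x} {c = c} {y = y} r q) d
  with ⇒D-++⁻ (encode (a · b) x) d
... | inj₁ (_ , d' , refl) with ⇒D-lift r d'
...   | _ , st , e = _ , appˡ y st , cong (_++ encode c y) e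
⇒D-lift (app·-cong {a = a} {b = b} {x = x} {c = c} {y = y} r q) d
  | inj₂ (_ , d' , refl) with ⇒D-lift q d'
... | _ , st , e = _ , appʳ x st , cong (encode (a · b) x ++_) e

record Realisation (t u : Term) (f : Forest) : Set where
  field
    term      : Term
    reachable : u ≼ term
    reduct    : Reduct t term
    encodes   : encode t term ≡ f

open Realisation

≪-lift : ∀ {t} → Reduct t u → encode t u ≪ f → Realisation t u f
≪-lift r ⋆ε = record { term = _ ; reachable = ⋆ε ; reduct = r ; encodes = refl }
≪-lift r (d ◅ p) with ⇒D-lift r d
... | _ , st , refl with ≪-lift (proj₁ (Reduct-⇒ r st)) p
...   | record { term = w ; reachable = p' ; reduct = r' ; encodes = e } =
  record { term = w ; reachable = st ◅ p' ; reduct = r' ; encodes = e }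

proposition2p4 : (t : Term) → PosetIso t (fr t)
proposition2p4 t = record
  { to        = λ (u , p) → encode t u ,
                  subst (_≪ encode t u) (encode-refl t) (encode-mono (Reduct-refl t) p)
  ; from      = λ y → term (lift y) , reachable (lift y)
  ; from∘to   = λ (u , p) → encode-injective (reduct (lift _)) (reductOf p) (encodes (lift _))
  ; to∘from   = λ y → encodes (lift y)
  ; to-cong   = λ _ _ → cong (encode t)
  ; from-cong = λ x y e → encode-injective (reduct (lift x)) (reduct (lift y))
                            (trans (encodes (lift x)) (trans e (sym (encodes (lift y)))))
  ; order     = λ (u , p) (v , q) → mk⇔ (encode-mono (reductOf p)) λ enc≪ →
                  let w = ≪-lift (reductOf p) enc≪ in
                  subst (u ≼_) (encode-injective (reduct w) (reductOf q) (encodes w)) (reachable w)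
  }
  where
  reductOf : t ≼ u → Reduct t u
  reductOf = Reduct-≼ (Reduct-refl t)

  lift : ((f , _) : 𝒟* (fr t)) → Realisation t t f
  lift (f , q) = ≪-lift (Reduct-refl t) (subst (_≪ f) (sym (encode-refl t)) q)
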